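{- Let $(S,\leq)$ be a continuous dcwo. For any Scott-closed subset $F$ of $S$, $\mathrm{Max}\,F$ is finite and $F={\downarrow}\mathrm{Max}\,F$.
   Context: A directed subset is a nonempty set in which any two elements have an upper bound in the set. A dcpo is a poset in which every directed subset $D$ has a least upper bound $\bigvee D$. $y\ll x$ iff for every directed $D$ with $\bigvee D\geq x$ there is $z\in D$ with $y\leq z$; a dcpo is continuous iff for every $x$ the set $\{y\mid y\ll x\}$ is directed with supremum $x$. A well partial order is a poset in which every infinite sequence has $i<j$ with $x_i\leq x_j$; a dcwo is a dcpo whose order is a well partial order. A set is Scott-open iff it is upward-closed and meets every directed set whose supremum it contains; Scott-closed sets are the complements of Scott-open sets. $\mathrm{Max}\,F$ is the set of maximal elements of $F$ and ${\downarrow}E=\{y\mid\exists x\in E, y\leq x\}$. -}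

module Defs where

open import Level using (Level; _⊔_; suc)
open import Data.Nat using (ℕ; _<_)
open import Data.Product using (Σ; _×_; ∃; ∃-syntax; _,_)
open import Data.List using (List)
open import Data.List.Relation.Unary.Any using (Any)
open import Data.List.Relation.Unary.All using (All)
open import Relation.Nullary using (¬_)
open import Relation.Unary using (Pred)
open import Relation.Binary.Bundles using (Poset)

module _ {c ℓ₁ ℓ₂ : Level} (P : Poset c ℓ₁ ℓ₂) where
  open Poset P renaming (Carrier to S)

  Directed : ∀ {ℓ} → Pred S ℓ → Set (c ⊔ ℓ₂ ⊔ ℓ)
  Directed D = (∃[ x ] D x)
             × (∀ x y → D x → D y → ∃[ z ] (D z × x ≤ z × y ≤ z))

  IsLub : ∀ {ℓ} → Pred S ℓ → S → Set (c ⊔ ℓ₂ ⊔ ℓ)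
  IsLub D s = (∀ x → D x → x ≤ s) × (∀ u → (∀ x → D x → x ≤ u) → s ≤ u)

  IsDcpo : (ℓ : Level) → Set (c ⊔ ℓ₂ ⊔ suc ℓ)
  IsDcpo ℓ = (D : Pred S ℓ) → Directed D → ∃[ s ] IsLub D s

  WayBelow : (ℓ : Level) → S → S → Set (c ⊔ ℓ₂ ⊔ suc ℓ)
  WayBelow ℓ y x = (D : Pred S ℓ) → Directed D → ∀ s → IsLub D s → x ≤ s
                 → ∃[ z ] (D z × y ≤ z)

  IsContinuous : (ℓ : Level) → Set (c ⊔ ℓ₂ ⊔ suc ℓ)
  IsContinuous ℓ = ∀ x → Directed (λ y → WayBelow ℓ y x) × IsLub (λ y → WayBelow ℓ y x) x

  IsWPO : Set (c ⊔ ℓ₂)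
  IsWPO = (f : ℕ → S) → ∃[ i ] ∃[ j ] (i < j × f i ≤ f j)

  IsDcwo : (ℓ : Level) → Set (c ⊔ ℓ₂ ⊔ suc ℓ)
  IsDcwo ℓ = IsDcpo ℓ × IsWPO

  ScottOpen : (ℓ : Level) → Pred S ℓ → Set (c ⊔ ℓ₂ ⊔ suc ℓ)
  ScottOpen ℓ U = (∀ x y → x ≤ y → U x → U y)
                × ((D : Pred S ℓ) → Directed D → ∀ s → IsLub D s → U s → ∃[ d ] (D d × U d))

  ScottClosed : (ℓ : Level) → Pred S ℓ → Set (c ⊔ ℓ₂ ⊔ suc ℓ)
  ScottClosed ℓ F = ScottOpen ℓ (λ x → ¬ F x)

  Max : ∀ {ℓ} → Pred S ℓ → Pred S (c ⊔ ℓ₁ ⊔ ℓ₂ ⊔ ℓ)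
  Max F x = F x × (∀ y → F y → x ≤ y → y ≈ x)

  ↓_ : ∀ {ℓ} → Pred S ℓ → Pred S (c ⊔ ℓ₂ ⊔ ℓ)
  ↓ E = λ y → ∃[ x ] (E x × y ≤ x)

  FiniteSet : ∀ {ℓ} → Pred S ℓ → Set (c ⊔ ℓ₁ ⊔ ℓ)
  FiniteSet E = ∃[ xs ] (All E xs × (∀ y → E y → Any (y ≈_) xs))

module Submission where

-- Call F finitely generated if F is the down-closure of a finite list L ⊆ F.
--  * Finite combinatorics: if F is finitely generated by L, every element of F
--    lies below an element of L that is maximal within L, such elements are
--    maximal in F, and every maximal element of F is ≈ to an element of L.
--    So it suffices to show that every Scott-closed set is finitely generated.
--  * Well partial order: there is no infinite strictly descending chain
--    G₀ ⊋ G₁ ⊋ … of down-closed sets (the dropped points xₙ ∈ Gₙ ∖ Gₙ₊₁ would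
--    admit xᵢ ≤ xⱼ with i < j, forcing xᵢ ∈ Gᵢ₊₁).
--  * Continuity: a Scott-closed G that is not finitely generated has a proper
--    Scott-closed subset that is again not finitely generated.  If the set of
--    approximants {y | y ≪ a for some a ∈ G} is directed, its supremum is a top
--    element of G.  Otherwise two approximants y₁, y₂ have no common upper
--    approximant; then G is covered by the two proper subsets
--    {x ∈ G | ¬ yᵢ ≪ x}, which are Scott-closed by interpolation, so one of
--    them is not finitely generated.
-- Iterating the last step from a non-finitely-generated F would contradict the
-- second point, which proves the theorem.

open import Defs
open import Level using (Level; suc; lift; lower)
open import Data.Product using (_×_; _,_; proj₁; proj₂; ∃-syntax)
open import Data.Sum using (inj₁; inj₂)
open import Data.Nat using (ℕ; zero; _≤′_; ≤′-refl; ≤′-step) renaming (suc to succ)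
open import Data.Nat.Properties using (≤⇒≤′)
open import Data.List using (List; []; _∷_; _++_; filter)
open import Data.List.Relation.Unary.Any using (Any; here; there)
import Data.List.Relation.Unary.Any as Any
open import Data.List.Relation.Unary.Any.Properties using (++⁺ˡ; ++⁺ʳ)
open import Data.List.Relation.Unary.All using (All; []; _∷_)
import Data.List.Relation.Unary.All as All
open import Data.List.Relation.Unary.All.Properties using (¬Any⇒All¬; all-filter) renaming (++⁺ to All-++⁺)
open import Data.List.Membership.Propositional using (_∈_; find)
open import Data.List.Membership.Propositional.Properties using (∈-filter⁺)
open import Data.Empty using (⊥-elim)
open import Relation.Nullary using (¬_; Dec; yes; no)
open import Relation.Nullary.Decidable using (True; toWitness; fromWitness; map′)
open import Relation.Unary using (Pred; Decidable; _⊆_; _∪_)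
open import Relation.Binary.Bundles using (Poset)
import Relation.Binary.PropositionalEquality as ≡
open import Axiom.ExcludedMiddle using (ExcludedMiddle)

module ScottClosedSets {ℓ : Level} (em : ExcludedMiddle (suc ℓ)) (P : Poset ℓ ℓ ℓ) where
  open Poset P renaming (Carrier to S)

  decide : {A : Set ℓ} → Dec A
  decide = map′ lower lift em

  -- Excluded middle makes every large proposition equivalent to a small one;
  -- needed because directed sets and predicates in the hypotheses live at ℓ.
  record Resize (A : Set (suc ℓ)) : Set ℓ where
    constructor mkResize
    field evidence : True (em {A})

  resize : {A : Set (suc ℓ)} → A → Resize A
  resize a = mkResize (fromWitness a)

  unresize : {A : Set (suc ℓ)} → Resize A → A
  unresize (mkResize t) = toWitness t

  Closed : Pred S ℓ → Set (suc ℓ)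
  Closed = ScottClosed P ℓ

  DownClosed : Pred S ℓ → Set ℓ
  DownClosed G = ∀ {x y} → x ≤ y → G y → G x

  closed⇒downClosed : ∀ {G} → Closed G → DownClosed G
  closed⇒downClosed {G} (upper , _) {x} {y} x≤y Gy with decide {G x}
  ... | yes Gx = Gx
  ... | no ¬Gx = ⊥-elim (upper x y x≤y ¬Gx Gy)

  closed-sup : ∀ {G} → Closed G → (D : Pred S ℓ) → Directed P D → D ⊆ G
             → ∀ {s} → IsLub P D s → G s
  closed-sup {G} (_ , inaccessible) D D-dir D⊆G {s} lub with decide {G s}
  ... | yes Gs = Gs
  ... | no ¬Gs = let (_ , Dd , ¬Gd) = inaccessible D D-dir s lub ¬Gs in ⊥-elim (¬Gd (D⊆G Dd))

  FinGen : Pred S ℓ → Set ℓ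
  FinGen G = ∃[ L ] (All G L × (∀ x → G x → Any (x ≤_) L))

  finGen-∪ : ∀ {G G₁ G₂} → G ⊆ G₁ ∪ G₂ → G₁ ⊆ G → G₂ ⊆ G
           → FinGen G₁ → FinGen G₂ → FinGen G
  finGen-∪ {G} G⊆ G₁⊆G G₂⊆G (L₁ , L₁⊆ , cover₁) (L₂ , L₂⊆ , cover₂) =
    L₁ ++ L₂ , All-++⁺ (All.map G₁⊆G L₁⊆) (All.map G₂⊆G L₂⊆) , cover
    where
    cover : ∀ x → G x → Any (x ≤_) (L₁ ++ L₂)
    cover x Gx with G⊆ Gx
    ... | inj₁ G₁x = ++⁺ˡ (cover₁ x G₁x)
    ... | inj₂ G₂x = ++⁺ʳ L₁ (cover₂ x G₂x)

  record StrictDescent : Set (suc ℓ) where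
    field
      level      : ℕ → Pred S ℓ
      downClosed : ∀ n → DownClosed (level n)
      descending : ∀ n → level (succ n) ⊆ level n
      dropped    : ℕ → S
      dropped∈   : ∀ n → level n (dropped n)
      dropped∉   : ∀ n → ¬ level (succ n) (dropped n)

  noStrictDescent : IsWPO P → ¬ StrictDescent
  noStrictDescent wpo chain =
    let (i , j , i<j , xᵢ≤xⱼ) = wpo dropped
    in dropped∉ i (downClosed (succ i) xᵢ≤xⱼ (antitone (≤⇒≤′ i<j) (dropped∈ j)))
    where
    open StrictDescent chain
    antitone : ∀ {i j} → i ≤′ j → level j ⊆ level i
    antitone ≤′-refl g = g
    antitone (≤′-step i≤j) g = antitone i≤j (descending _ g)

  MaximalIn : List S → S → Set ℓ
  MaximalIn M m = All (λ l → m ≤ l → l ≤ m) M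

  TopAbove : List S → S → Set ℓ
  TopAbove M x = ∃[ m ] (m ∈ M × x ≤ m × MaximalIn M m)

  raise : ∀ {M x y} → x ≤ y → TopAbove M y → TopAbove M x
  raise x≤y (m , m∈M , y≤m , max) = m , m∈M , trans x≤y y≤m , max

  mutual
    topAboveHead : ∀ l M → TopAbove (l ∷ M) l
    topAboveHead l M with decide {Any (l ≤_) M}
    ... | no nothingAbove =
      l , here ≡.refl , refl ,
      (λ _ → refl) ∷ All.map (λ l≰ l≤ → ⊥-elim (l≰ l≤)) (¬Any⇒All¬ M nothingAbove)
    ... | yes above =
      let (m , m∈M , l≤m , max) = topAbove M above in m , there m∈M , l≤m , (λ _ → l≤m) ∷ max

    topAbove : ∀ {x} M → Any (x ≤_) M → TopAbove M x
    topAbove (l ∷ M) (here x≤l) = raise x≤l (topAboveHead l M)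
    topAbove (l ∷ M) (there below) with topAbove M below
    ... | m , m∈M , x≤m , max with decide {m ≤ l}
    ...   | yes m≤l = raise (trans x≤m m≤l) (topAboveHead l M)
    ...   | no m≰l = m , there m∈M , x≤m , (λ m≤l → ⊥-elim (m≰l m≤l)) ∷ max

  Max-above : ∀ {F : Pred S ℓ} {m l} → Max P F m → F l → m ≤ l → Max P F l
  Max-above (_ , maxm) Fl m≤l =
    Fl , λ y Fy l≤y → Eq.trans (maxm y Fy (trans m≤l l≤y)) (Eq.sym (maxm _ Fl m≤l))

  ↓Max⊆ : ∀ {F : Pred S ℓ} → DownClosed F → ↓_ P (Max P F) ⊆ F
  ↓Max⊆ downF (_ , (Fm , _) , x≤m) = downF x≤m Fm

  module Generated {F : Pred S ℓ} (fg : FinGen F) where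
    L : List S
    L = proj₁ fg

    L⊆F : All F L
    L⊆F = proj₁ (proj₂ fg)

    cover : ∀ x → F x → Any (x ≤_) L
    cover = proj₂ (proj₂ fg)

    maximalIn⇒Max : ∀ {m} → m ∈ L → MaximalIn L m → Max P F m
    maximalIn⇒Max {m} m∈L max = All.lookup L⊆F m∈L , above
      where
      above : ∀ y → F y → m ≤ y → y ≈ m
      above y Fy m≤y =
        let (l , l∈L , y≤l) = find (cover y Fy)
        in antisym (trans y≤l (All.lookup max l∈L (trans m≤y y≤l))) m≤y

    below-Max : F ⊆ ↓_ P (Max P F)
    below-Max Fx =
      let (m , m∈L , x≤m , max) = topAbove L (cover _ Fx) in m , maximalIn⇒Max m∈L max , x≤m

    Max? : Decidable (Max P F)
    Max? _ = decide

    Max-finite : FiniteSet P (Max P F)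
    Max-finite = filter Max? L , all-filter Max? L , listed
      where
      listed : ∀ m → Max P F m → Any (m ≈_) (filter Max? L)
      listed m Mm@(Fm , maxm) =
        let (l , l∈L , m≤l) = find (cover m Fm)
            Fl = All.lookup L⊆F l∈L
            m≈l = Eq.sym (maxm l Fl m≤l)
        in Any.map (λ { ≡.refl → m≈l }) (∈-filter⁺ Max? l∈L (Max-above Mm Fl m≤l))

  module Continuous (dcpo : IsDcpo P ℓ) (cont : IsContinuous P ℓ) where
    _≪_ : S → S → Set (suc ℓ)
    _≪_ = WayBelow P ℓ

    approximants-directed : ∀ x → Directed P (_≪ x)
    approximants-directed x = proj₁ (cont x)

    approximants-bound : ∀ {x s} → (∀ y → y ≪ x → y ≤ s) → x ≤ s
    approximants-bound {x} {s} = proj₂ (proj₂ (cont x)) s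

    ≪⇒≤ : ∀ {y x} → y ≪ x → y ≤ x
    ≪⇒≤ {y} {x} y≪x = let (_ , z≤x , y≤z) = y≪x (_≤ x) ↓x-directed x ↓x-lub refl in trans y≤z z≤x
      where
      ↓x-directed : Directed P (_≤ x)
      ↓x-directed = (x , refl) , λ _ _ a≤x b≤x → x , refl , a≤x , b≤x
      ↓x-lub : IsLub P (_≤ x) x
      ↓x-lub = (λ _ a≤x → a≤x) , (λ _ bound → bound x refl)

    ≤-≪ : ∀ {y w x} → y ≤ w → w ≪ x → y ≪ x
    ≤-≪ y≤w w≪x D D-dir s lub x≤s = let (d , Dd , w≤d) = w≪x D D-dir s lub x≤s in d , Dd , trans y≤w w≤d

    ≪-≤ : ∀ {y w x} → y ≪ w → w ≤ x → y ≪ x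
    ≪-≤ y≪w w≤x D D-dir s lub x≤s = y≪w D D-dir s lub (trans w≤x x≤s)

    -- Interpolation: the elements way below some approximant of x form a
    -- directed set whose supremum is above x, so y ≪ x is caught by one of them.
    interpolate : ∀ {y x} → y ≪ x → ∃[ z ] (y ≪ z × z ≪ x)
    interpolate {y} {x} y≪x =
      let (_ , Dw , y≤w) = y≪x D D-directed s lub x≤s
          (z , z≪x , w≪z) = unresize Dw
      in z , ≤-≪ y≤w w≪z , z≪x
      where
      D : Pred S ℓ
      D w = Resize (∃[ z ] (z ≪ x × w ≪ z))

      D-directed : Directed P D
      D-directed = nonempty , bound
        where
        nonempty : ∃[ w ] D w
        nonempty =
          let (z , z≪x) = proj₁ (approximants-directed x)
              (w , w≪z) = proj₁ (approximants-directed z)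
          in w , resize (z , z≪x , w≪z)
        bound : ∀ a b → D a → D b → ∃[ c ] (D c × a ≤ c × b ≤ c)
        bound a b Da Db =
          let (z₁ , z₁≪x , a≪z₁) = unresize Da
              (z₂ , z₂≪x , b≪z₂) = unresize Db
              (z , z≪x , z₁≤z , z₂≤z) = proj₂ (approximants-directed x) z₁ z₂ z₁≪x z₂≪x
              (c , c≪z , a≤c , b≤c) = proj₂ (approximants-directed z) a b (≪-≤ a≪z₁ z₁≤z) (≪-≤ b≪z₂ z₂≤z)
          in c , resize (z , z≪x , c≪z) , a≤c , b≤c

      s : S
      s = proj₁ (dcpo D D-directed)

      lub : IsLub P D s
      lub = proj₂ (dcpo D D-directed)

      x≤s : x ≤ s
      x≤s = approximants-bound λ z z≪x → approximants-bound λ w w≪z → proj₁ lub w (resize (z , z≪x , w≪z))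

    Cut : Pred S ℓ → S → Pred S ℓ
    Cut G y x = Resize (G x × ¬ (y ≪ x))

    cut⊆ : ∀ G y → Cut G y ⊆ G
    cut⊆ _ _ c = proj₁ (unresize c)

    -- Cutting a Scott-closed set keeps it Scott-closed (by interpolation).
    cut-closed : ∀ {G} → Closed G → ∀ y → Closed (Cut G y)
    cut-closed {G} closedG@(_ , inaccessible) y = upper , inaccessible′
      where
      upper : ∀ x x′ → x ≤ x′ → ¬ Cut G y x → ¬ Cut G y x′
      upper x x′ x≤x′ ¬cx cx′ =
        let (Gx′ , ¬y≪x′) = unresize cx′
        in ¬cx (resize (closed⇒downClosed closedG x≤x′ Gx′ , λ y≪x → ¬y≪x′ (≪-≤ y≪x x≤x′)))

      inaccessible′ : (D : Pred S ℓ) → Directed P D → ∀ s → IsLub P D s → ¬ Cut G y s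
                    → ∃[ d ] (D d × ¬ Cut G y d)
      inaccessible′ D D-dir s lub ¬cs with decide {G s} | em {y ≪ s}
      ... | no ¬Gs | _ =
        let (d , Dd , ¬Gd) = inaccessible D D-dir s lub ¬Gs in d , Dd , λ cd → ¬Gd (cut⊆ G y cd)
      ... | yes Gs | no ¬y≪s = ⊥-elim (¬cs (resize (Gs , ¬y≪s)))
      ... | yes _ | yes y≪s =
        let (z , y≪z , z≪s) = interpolate y≪s
            (d , Dd , z≤d) = z≪s D D-dir s lub refl
        in d , Dd , λ cd → proj₂ (unresize cd) (≪-≤ y≪z z≤d)

    Approx : Pred S ℓ → Pred S ℓ
    Approx G y = Resize (∃[ a ] (G a × y ≪ a))

    Incompatible : Pred S ℓ → Set ℓ
    Incompatible G = ∃[ y₁ ] ∃[ y₂ ] (Approx G y₁ × Approx G y₂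
                                      × ¬ (∃[ z ] (Approx G z × y₁ ≤ z × y₂ ≤ z)))

    approx-directed : ∀ {G} → ∃[ a ] G a → ¬ Incompatible G → Directed P (Approx G)
    approx-directed {G} (a , Ga) compatible = nonempty , bound
      where
      nonempty : ∃[ y ] Approx G y
      nonempty = let (y , y≪a) = proj₁ (approximants-directed a) in y , resize (a , Ga , y≪a)

      bound : ∀ y₁ y₂ → Approx G y₁ → Approx G y₂ → ∃[ z ] (Approx G z × y₁ ≤ z × y₂ ≤ z)
      bound y₁ y₂ A₁ A₂ with decide {∃[ z ] (Approx G z × y₁ ≤ z × y₂ ≤ z)}
      ... | yes ub = ub
      ... | no ¬ub = ⊥-elim (compatible (y₁ , y₂ , A₁ , A₂ , ¬ub))

    -- If the approximants of a Scott-closed G are directed, their supremum is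
    -- in G and above every element of G.
    directed⇒finGen : ∀ {G} → Closed G → Directed P (Approx G) → FinGen G
    directed⇒finGen {G} closedG dir =
      let (s , lub) = dcpo (Approx G) dir
      in s ∷ [] , closed-sup closedG (Approx G) dir approx⊆G lub ∷ [] ,
         λ x Gx → here (approximants-bound λ y y≪x → proj₁ lub y (resize (x , Gx , y≪x)))
      where
      approx⊆G : Approx G ⊆ G
      approx⊆G A = let (_ , Ga , y≪a) = unresize A in closed⇒downClosed closedG (≪⇒≤ y≪a) Ga

    -- Two approximants without common upper approximant cut G into two pieces,
    -- since the approximants of each x are directed.
    cuts-cover : ∀ {G y₁ y₂} → ¬ (∃[ z ] (Approx G z × y₁ ≤ z × y₂ ≤ z))
               → G ⊆ Cut G y₁ ∪ Cut G y₂
    cuts-cover {G} {y₁} {y₂} noBound {x} Gx with em {y₁ ≪ x} | em {y₂ ≪ x}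
    ... | no ¬y₁≪x | _ = inj₁ (resize (Gx , ¬y₁≪x))
    ... | yes _ | no ¬y₂≪x = inj₂ (resize (Gx , ¬y₂≪x))
    ... | yes y₁≪x | yes y₂≪x =
      let (z , z≪x , y₁≤z , y₂≤z) = proj₂ (approximants-directed x) y₁ y₂ y₁≪x y₂≪x
      in ⊥-elim (noBound (z , resize (x , Gx , z≪x) , y₁≤z , y₂≤z))

    record Shrinking (G : Pred S ℓ) : Set (suc ℓ) where
      field
        smaller    : Pred S ℓ
        closed     : Closed smaller
        notFinGen  : ¬ FinGen smaller
        smaller⊆G  : smaller ⊆ G
        witness    : S
        witness∈G  : G witness
        witness∉   : ¬ smaller witness

    -- A cut at an approximant of G is proper: it misses the point approximated.
    cut-shrinking : ∀ {G y} → Closed G → ¬ FinGen (Cut G y) → Approx G y → Shrinking G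
    cut-shrinking {G} {y} closedG ¬fg A =
      let (a , Ga , y≪a) = unresize A
      in record { smaller = Cut G y ; closed = cut-closed closedG y ; notFinGen = ¬fg
                ; smaller⊆G = cut⊆ G y ; witness = a ; witness∈G = Ga
                ; witness∉ = λ c → proj₂ (unresize c) y≪a }

    shrink : ∀ {G} → Closed G → ¬ FinGen G → Shrinking G
    shrink {G} closedG ¬fg with decide {∃[ a ] G a}
    ... | no empty = ⊥-elim (¬fg ([] , [] , λ x Gx → ⊥-elim (empty (x , Gx))))
    ... | yes inhabited with decide {Incompatible G}
    ...   | no compatible = ⊥-elim (¬fg (directed⇒finGen closedG (approx-directed inhabited compatible)))
    ...   | yes (y₁ , y₂ , A₁ , A₂ , noBound) with decide {FinGen (Cut G y₁)} | decide {FinGen (Cut G y₂)}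
    ...     | no ¬fg₁ | _ = cut-shrinking closedG ¬fg₁ A₁
    ...     | yes _ | no ¬fg₂ = cut-shrinking closedG ¬fg₂ A₂
    ...     | yes fg₁ | yes fg₂ = ⊥-elim (¬fg (finGen-∪ (cuts-cover noBound) (cut⊆ G y₁) (cut⊆ G y₂) fg₁ fg₂))

    NonFinGenClosed : Set (suc ℓ)
    NonFinGenClosed = ∃[ G ] (Closed G × ¬ FinGen G)

    descent : NonFinGenClosed → StrictDescent
    descent start = record
      { level = λ n → proj₁ (chain n)
      ; downClosed = λ n → closed⇒downClosed (proj₁ (proj₂ (chain n)))
      ; descending = λ n → Shrinking.smaller⊆G (step (chain n))
      ; dropped = λ n → Shrinking.witness (step (chain n))
      ; dropped∈ = λ n → Shrinking.witness∈G (step (chain n))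
      ; dropped∉ = λ n → Shrinking.witness∉ (step (chain n))
      }
      where
      step : (st : NonFinGenClosed) → Shrinking (proj₁ st)
      step (_ , closedG , ¬fg) = shrink closedG ¬fg

      chain : ℕ → NonFinGenClosed
      chain zero = start
      chain (succ n) = let open Shrinking (step (chain n)) in smaller , closed , notFinGen

    closed⇒finGen : IsWPO P → ∀ {F} → Closed F → FinGen F
    closed⇒finGen wpo {F} closedF with decide {FinGen F}
    ... | yes fg = fg
    ... | no ¬fg = ⊥-elim (noStrictDescent wpo (descent (F , closedF , ¬fg)))

lemma3p5 : {ℓ : Level} → ExcludedMiddle (suc ℓ) → (P : Poset ℓ ℓ ℓ)
    → IsDcwo P ℓ → IsContinuous P ℓ
    → (F : Pred (Poset.Carrier P) ℓ) → ScottClosed P ℓ F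
    → FiniteSet P (Max P F) × (F ⊆ (↓_ P (Max P F)) × (↓_ P (Max P F)) ⊆ F)
lemma3p5 em P (dcpo , wpo) cont F closedF =
  Max-finite , below-Max , ↓Max⊆ (closed⇒downClosed closedF)
  where
  open ScottClosedSets em P
  open Continuous dcpo cont
  open Generated (closed⇒finGen wpo closedF)
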